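{- For $n\geq 2$ let $\Delta_n=c_{n+1}-c_n$. Then $\frac{n}{2}\leq \Delta_n\leq n$ for all $n\geq 2$.
   Context: The sequence $(c_n)_{n\geq 2}$ is defined by $c_2=1$, $c_3=2$, and $c_n=\lfloor \frac{n}{2}\rfloor\lceil \frac{n}{2}\rceil+c_{\lceil n/2\rceil}$ for $n>3$. -}

module Defs where

open import Data.Nat using (ℕ; zero; suc; _+_; _*_; _∸_; _/_)

⌊_/2⌋ : ℕ → ℕ
⌊ n /2⌋ = n / 2

⌈_/2⌉ : ℕ → ℕ
⌈ n /2⌉ = suc n / 2

-- fuel-based evaluation of the recurrence; fuel ≥ n suffices since ⌈n/2⌉ < n for n > 3
cAux : ℕ → ℕ → ℕ
cAux zero    n = 0
cAux (suc f) 0 = 0   -- c_0, c_1 are not part of the sequence (junk values)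
cAux (suc f) 1 = 0
cAux (suc f) 2 = 1
cAux (suc f) 3 = 2
cAux (suc f) n@(suc (suc (suc (suc _)))) = ⌊ n /2⌋ * ⌈ n /2⌉ + cAux f ⌈ n /2⌉

c : ℕ → ℕ
c n = cAux n n

Δ : ℕ → ℕ
Δ n = c (suc n) ∸ c n

{-# OPTIONS --safe #-}
module Submission where

-- For m ≥ 2 the recurrence reads c(2m) = m² + c(m) and c(2m+1) = m(m+1) + c(m+1).
-- Subtracting, Δ(2m+1) = (m+1)² - m(m+1) = m+1, which lies in [(2m+1)/2, 2m+1],
-- and Δ(2m) = m + Δ(m), so Δ(m) ≤ m gives Δ(2m) ≤ 2m while Δ(2m) ≥ m is automatic.
-- Strong induction from Δ(2) = 1 and Δ(3) = 3 finishes; the lower bound makes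
-- every Δ(n) positive, so c is increasing.

open import Defs
open import Data.Nat using (ℕ; zero; suc; _≤_; _<_; _*_; _+_; _∸_; _/_; z≤n; s≤s)
import Data.Nat.Base as ℕ
open import Data.Nat.DivMod using (m/n≡1+[m∸n]/n)
open import Data.Nat.Induction using (<-rec)
open import Data.Nat.Properties
  using ( +-comm; +-suc; +-identityʳ; ≤-refl; ≤-trans; ≤-pred; <⇒≤; n≤1+n; m≤n⇒m≤1+n
        ; m≤m+n; m<m+n; +-mono-≤; +-monoʳ-≤; *-cancelˡ-≤; n>0⇒n≢0
        ; +-∸-assoc; [m+n]∸[m+o]≡n∸o; m+n∸m≡n; m∸n≢0⇒n<m
        ; n≡⌊n+n/2⌋; n≡⌈n+n/2⌉; ⌈n/2⌉<n )
open import Data.Nat.Tactic.RingSolver using (solve-∀)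
open import Data.Product using (_×_; _,_)
open import Relation.Binary.PropositionalEquality
  using (_≡_; refl; sym; trans; cong; cong₂; subst; module ≡-Reasoning)

n/2≡⌊n/2⌋ : ∀ n → n / 2 ≡ ℕ.⌊ n /2⌋
n/2≡⌊n/2⌋ zero = refl
n/2≡⌊n/2⌋ (suc zero) = refl
n/2≡⌊n/2⌋ (suc (suc n)) = trans (m/n≡1+[m∸n]/n {suc (suc n)} (s≤s (s≤s z≤n))) (cong suc (n/2≡⌊n/2⌋ n))

[m+m]/2≡m : ∀ m → (m + m) / 2 ≡ m
[m+m]/2≡m m = trans (n/2≡⌊n/2⌋ (m + m)) (sym (n≡⌊n+n/2⌋ m))

[1+m+m]/2≡m : ∀ m → suc (m + m) / 2 ≡ m
[1+m+m]/2≡m m = trans (n/2≡⌊n/2⌋ (suc (m + m))) (sym (n≡⌈n+n/2⌉ m))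

[2+m+m]/2≡1+m : ∀ m → suc (suc (m + m)) / 2 ≡ suc m
[2+m+m]/2≡1+m m = trans (n/2≡⌊n/2⌋ (suc (suc (m + m)))) (cong suc (sym (n≡⌊n+n/2⌋ m)))

⌈4+k/2⌉≤3+k : ∀ k → ⌈ 4 + k /2⌉ ≤ 3 + k
⌈4+k/2⌉≤3+k k = ≤-pred (subst (_< 4 + k) (sym (n/2≡⌊n/2⌋ (5 + k))) (⌈n/2⌉<n (2 + k)))

cAux-fuel : ∀ {f g n} → n ≤ f → n ≤ g → cAux f n ≡ cAux g n
cAux-fuel {zero}  {zero}  {zero} _ _ = refl
cAux-fuel {zero}  {suc g} {zero} _ _ = refl
cAux-fuel {suc f} {zero}  {zero} _ _ = refl
cAux-fuel {suc f} {suc g} {zero} _ _ = refl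
cAux-fuel {suc f} {suc g} {1}    _ _ = refl
cAux-fuel {suc f} {suc g} {2}    _ _ = refl
cAux-fuel {suc f} {suc g} {3}    _ _ = refl
cAux-fuel {suc f} {suc g} {n@(suc (suc (suc (suc k))))} (s≤s n≤f) (s≤s n≤g) =
  cong (⌊ n /2⌋ * ⌈ n /2⌉ +_) (cAux-fuel (≤-trans (⌈4+k/2⌉≤3+k k) n≤f) (≤-trans (⌈4+k/2⌉≤3+k k) n≤g))

c-unfold : ∀ {n} → 4 ≤ n → c n ≡ ⌊ n /2⌋ * ⌈ n /2⌉ + c ⌈ n /2⌉
c-unfold {n@(suc (suc (suc (suc k))))} (s≤s (s≤s (s≤s (s≤s _)))) =
  cong (⌊ n /2⌋ * ⌈ n /2⌉ +_) (cAux-fuel (⌈4+k/2⌉≤3+k k) ≤-refl)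

c-double : ∀ {m} → 2 ≤ m → c (m + m) ≡ m * m + c m
c-double {m} m≥2 = begin
  c (m + m)                                    ≡⟨ c-unfold (+-mono-≤ m≥2 m≥2) ⟩
  ⌊ m + m /2⌋ * ⌈ m + m /2⌉ + c ⌈ m + m /2⌉    ≡⟨ cong₂ (λ a b → a * b + c b) ([m+m]/2≡m m) ([1+m+m]/2≡m m) ⟩
  m * m + c m                                  ∎
  where open ≡-Reasoning

c-double+1 : ∀ {m} → 2 ≤ m → c (suc (m + m)) ≡ m * suc m + c (suc m)
c-double+1 {m} m≥2 = begin
  c (suc (m + m))                                          ≡⟨ c-unfold (m≤n⇒m≤1+n (+-mono-≤ m≥2 m≥2)) ⟩
  ⌊ suc (m + m) /2⌋ * ⌈ suc (m + m) /2⌉ + c ⌈ suc (m + m) /2⌉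
    ≡⟨ cong₂ (λ a b → a * b + c b) ([1+m+m]/2≡m m) ([2+m+m]/2≡1+m m) ⟩
  m * suc m + c (suc m)                                    ∎
  where open ≡-Reasoning

Δ-double+1 : ∀ {m} → 2 ≤ m → Δ (suc (m + m)) ≡ suc m
Δ-double+1 {m} m≥2 = begin
  c (suc (suc (m + m))) ∸ c (suc (m + m))                  ≡⟨ cong₂ _∸_ c-double-suc (c-double+1 m≥2) ⟩
  suc m * suc m + c (suc m) ∸ (m * suc m + c (suc m))      ≡⟨ cong (_∸ (m * suc m + c (suc m))) (regroup m (c (suc m))) ⟩
  m * suc m + c (suc m) + suc m ∸ (m * suc m + c (suc m))  ≡⟨ m+n∸m≡n (m * suc m + c (suc m)) (suc m) ⟩
  suc m                                                    ∎
  where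
  open ≡-Reasoning
  c-double-suc : c (suc (suc (m + m))) ≡ suc m * suc m + c (suc m)
  c-double-suc = trans (cong (λ k → c (suc k)) (sym (+-suc m m))) (c-double (m≤n⇒m≤1+n m≥2))
  regroup : ∀ m x → suc m * suc m + x ≡ m * suc m + x + suc m
  regroup = solve-∀

-- The hypothesis is needed because Δ is a truncated difference.
Δ-double : ∀ {m} → 2 ≤ m → c m ≤ c (suc m) → Δ (m + m) ≡ m + Δ m
Δ-double {m} m≥2 c-step = begin
  c (suc (m + m)) ∸ c (m + m)                      ≡⟨ cong₂ _∸_ (c-double+1 m≥2) (c-double m≥2) ⟩
  m * suc m + c (suc m) ∸ (m * m + c m)            ≡⟨ cong (_∸ (m * m + c m)) (regroup m (c (suc m))) ⟩
  m * m + (m + c (suc m)) ∸ (m * m + c m)          ≡⟨ [m+n]∸[m+o]≡n∸o (m * m) (m + c (suc m)) (c m) ⟩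
  m + c (suc m) ∸ c m                              ≡⟨ +-∸-assoc m c-step ⟩
  m + Δ m                                          ∎
  where
  open ≡-Reasoning
  regroup : ∀ m x → m * suc m + x ≡ m * m + (m + x)
  regroup = solve-∀

Δ>0⇒c[n]<c[1+n] : ∀ {n} → 0 < Δ n → c n < c (suc n)
Δ>0⇒c[n]<c[1+n] Δ>0 = m∸n≢0⇒n<m (n>0⇒n≢0 Δ>0)

ΔBounds : ℕ → Set
ΔBounds n = n ≤ 2 * Δ n × Δ n ≤ n

ΔBounds⇒c[n]<c[1+n] : ∀ {n} → 2 ≤ n → ΔBounds n → c n < c (suc n)
ΔBounds⇒c[n]<c[1+n] {n} n≥2 (lower , _) = Δ>0⇒c[n]<c[1+n] {n} (*-cancelˡ-≤ 2 (≤-trans n≥2 lower))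

n≤m+m⇒n≤2*m : ∀ {n m} → n ≤ m + m → n ≤ 2 * m
n≤m+m⇒n≤2*m {n} {m} = subst (λ k → n ≤ m + k) (sym (+-identityʳ m))

ΔBounds-double : ∀ {m} → 2 ≤ m → ΔBounds m → ΔBounds (m + m)
ΔBounds-double {m} m≥2 bounds@(_ , upper)
  rewrite Δ-double m≥2 (<⇒≤ (ΔBounds⇒c[n]<c[1+n] m≥2 bounds)) =
  n≤m+m⇒n≤2*m {m = m + Δ m} (+-mono-≤ (m≤m+n m (Δ m)) (m≤m+n m (Δ m))) , +-monoʳ-≤ m upper

ΔBounds-double+1 : ∀ {m} → 2 ≤ m → ΔBounds (suc (m + m))
ΔBounds-double+1 {m} m≥2 rewrite Δ-double+1 m≥2 =
  n≤m+m⇒n≤2*m {m = suc m} (s≤s (+-monoʳ-≤ m (n≤1+n m))) , s≤s (m≤m+n m m)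

data Parity : ℕ → Set where
  even : ∀ m → Parity (m + m)
  odd  : ∀ m → Parity (suc (m + m))

parity : ∀ n → Parity n
parity zero = even zero
parity (suc n) with parity n
... | even m = odd m
... | odd m  = subst Parity (cong suc (+-suc m m)) (even (suc m))

2≤n⇒ΔBounds : ∀ n → 2 ≤ n → ΔBounds n
2≤n⇒ΔBounds = <-rec (λ n → 2 ≤ n → ΔBounds n) (λ n ih → step (parity n) ih)
  where
  step : ∀ {n} → Parity n → (∀ {m} → m < n → 2 ≤ m → ΔBounds m) → 2 ≤ n → ΔBounds n
  step (even zero)                _  ()
  step (even (suc zero))          _  _ = ≤-refl , s≤s z≤n
  step (even m@(suc (suc _)))     ih _ = ΔBounds-double m≥2 (ih (m<m+n m (s≤s z≤n)) m≥2)
    where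
    m≥2 : 2 ≤ m
    m≥2 = s≤s (s≤s z≤n)
  step (odd zero)                 _  (s≤s ())
  step (odd (suc zero))           _  _ = s≤s (s≤s (s≤s z≤n)) , ≤-refl
  step (odd (suc (suc _)))        _  _ = ΔBounds-double+1 (s≤s (s≤s z≤n))

mainTheorem17 : (n : ℕ) → 2 ≤ n → c n ≤ c (n + 1) × n ≤ 2 * Δ n × Δ n ≤ n
mainTheorem17 n n≥2 rewrite +-comm n 1 =
  <⇒≤ (ΔBounds⇒c[n]<c[1+n] n≥2 bounds) , bounds
  where
  bounds : ΔBounds n
  bounds = 2≤n⇒ΔBounds n n≥2
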